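{- A countable graph $G$ lies in $\overline{\mathcal W}$ if and only if $G$ contains no comb all of whose teeth lie in $V^*(G)$.
   Context: For a graph $G$, let $V_\infty(G)$ be the set of vertices of infinite degree and let $V^*(G)$ be the set of vertices in $V_\infty(G)$ having only finitely many neighbours in $V_\infty(G)$. Let $\mathcal W$ be the class of countable graphs $G$ with $V^*(G)$ finite. For each ordinal $\mu$ define $\mathcal W(\mu)$ recursively: $\mathcal W(0)=\mathcal W$, and for $\mu>0$ a graph $G$ belongs to $\mathcal W(\mu)$ if it has a finite vertex set $S$ such that for every component $C$ of $G-S$ there is an ordinal $\lambda<\mu$ with $C\in\mathcal W(\lambda)$; $\overline{\mathcal W}$ is the union of all $\mathcal W(\lambda)$. A comb is the union of a ray (one-way infinite path) $R$ with infinitely many pairwise disjoint finite paths, each having exactly its first vertex on $R$ (paths may be trivial); the last vertices of these paths are the teeth of the comb. -}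

module Defs where

open import Level using (0ℓ)
open import Data.Nat using (ℕ; zero; suc; _<_)
open import Data.Fin using (Fin; fromℕ; inject₁) renaming (zero to fzero; suc to fsuc)
open import Data.List using (List)
open import Data.List.Membership.Propositional using (_∈_; _∉_)
open import Data.Product using (Σ; ∃; _×_; _,_)
open import Data.Empty using (⊥)
open import Relation.Nullary using (¬_)
open import Relation.Binary.PropositionalEquality using (_≡_; _≢_)

-- Countable (simple, undirected) graphs: the vertex set is a subset of ℕ.
-- Every countable graph is isomorphic to one of these.

record Graph : Set₁ where
  field
    V      : ℕ → Set
    E      : ℕ → ℕ → Set
    E-sym  : ∀ {x y} → E x y → E y x
    E-irr  : ∀ {x} → ¬ E x x
    E-V    : ∀ {x y} → E x y → V x × V y
open Graph public

-- A set of naturals is finite iff it is bounded.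
Finite : (ℕ → Set) → Set
Finite P = ∃ λ n → ∀ y → P y → y < n

Infinite : (ℕ → Set) → Set
Infinite P = ¬ Finite P

V∞ : Graph → ℕ → Set
V∞ G x = V G x × Infinite (E G x)

V* : Graph → ℕ → Set
V* G x = V∞ G x × Finite (λ y → E G x y × V∞ G y)

InW : Graph → Set
InW G = Finite (V* G)

induce : Graph → (ℕ → Set) → Graph
induce G P = record
  { V = λ x → V G x × P x
  ; E = λ x y → E G x y × P x × P y
  ; E-sym = λ { (e , px , py) → E-sym G e , py , px }
  ; E-irr = λ { (e , _ , _) → E-irr G e }
  ; E-V = λ { (e , px , py) → let (vx , vy) = E-V G e in (vx , px) , (vy , py) }
  }

_─_ : Graph → List ℕ → Graph
G ─ S = induce G (λ x → x ∉ S)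

data Reach (H : Graph) (v : ℕ) : ℕ → Set where
  here : V H v → Reach H v v
  step : ∀ {x y} → Reach H v x → E H x y → Reach H v y

component : Graph → ℕ → Graph
component H v = induce H (Reach H v)

-- 𝒲̄ = ⋃_μ 𝒲(μ), as the least class containing 𝒲 and closed under
-- "some finite S with all components of G - S in the class".
data InWbar : Graph → Set₁ where
  base : ∀ {G} → InW G → InWbar G
  sep  : ∀ {G} (S : List ℕ) →
         (∀ v → V (G ─ S) v → InWbar (component (G ─ S) v)) →
         InWbar G

record CombTeethInV* (G : Graph) : Set where
  field
    ray      : ℕ → ℕ
    ray-V    : ∀ n → V G (ray n)
    ray-inj  : ∀ m n → ray m ≡ ray n → m ≡ n
    ray-E    : ∀ n → E G (ray n) (ray (suc n))
    len      : ℕ → ℕ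
    path     : (k : ℕ) → Fin (suc (len k)) → ℕ
    path-V   : ∀ k i → V G (path k i)
    path-inj : ∀ k i j → path k i ≡ path k j → i ≡ j
    path-E   : ∀ k (i : Fin (len k)) → E G (path k (inject₁ i)) (path k (fsuc i))
    path-start : ∀ k → ∃ λ n → path k fzero ≡ ray n
    path-off   : ∀ k (i : Fin (len k)) n → path k (fsuc i) ≢ ray n
    path-disj  : ∀ k l i j → k ≢ l → path k i ≢ path l j
    teeth      : ∀ k → V* G (path k (fromℕ (len k)))

-- If G ∈ 𝒲̄, induct on the witness: in 𝒲 the teeth of a comb would be infinitely many distinct
-- vertices of the finite set V*(G); and after deleting a finite set S, a tail of the comb lies in
-- one component C of G − S, where V*(G) ∩ C ⊆ V*(C).
-- Conversely, if G ∉ 𝒲̄, some component C of G is not in 𝒲̄. Then V*(C) contains a vertex u;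
-- take a shortest path P in C from the current root to u. Some component C′ of C − P is still
-- not in 𝒲̄, and some edge q d joins P to C′. The ray follows P up to q and continues from the
-- root d in C′, where the construction is repeated; the tooth is the rest of P from q to u.
-- Paths of later stages lie in C′ and so miss P, and V* of an iterated component lies in V*(G).

module Submission where

open import Defs
open import Level using (0ℓ)
open import Axiom.ExcludedMiddle using (ExcludedMiddle)
open import Axiom.DoubleNegationElimination using (DoubleNegationElimination; em⇒dne)
open import Data.Nat as ℕ
  using (ℕ; zero; suc; _<_; _≤_; _≤′_; ≤′-refl; ≤′-step; _⊔_; _+_; _∸_; z≤n; s≤s; z<s; _<?_)
open import Data.Nat.Properties
open import Data.Nat.Induction using (<-rec)
open import Data.Fin using (Fin; toℕ; fromℕ<; fromℕ; inject₁) renaming (zero to fzero; suc to fsuc)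
import Data.Fin.Properties as Finₚ
open import Data.List using (List; []; _∷_; tabulate)
open import Data.List.Membership.Propositional using (_∈_; _∉_)
open import Data.List.Membership.Propositional.Properties using (∈-tabulate⁺; ∈-tabulate⁻)
open import Data.List.Membership.DecPropositional ℕ._≟_ using (_∈?_)
open import Data.List.Relation.Unary.Any using (here; there)
open import Data.Product using (Σ; ∃; _×_; _,_; proj₁; proj₂)
open import Data.Sum as Sum using (_⊎_; inj₁; inj₂; [_,_])
open import Data.Empty using (⊥; ⊥-elim)
open import Function using (_∘_; id)
open import Function.Definitions using (Injective)
open import Relation.Nullary using (¬_; yes; no)
open import Relation.Nullary.Decidable using (toSum)
open import Relation.Binary.Definitions using (tri<; tri≈; tri>)
open import Relation.Binary.PropositionalEquality hiding ([_])

Finite-⊆ : ∀ {A B : ℕ → Set} → (∀ {y} → A y → B y) → Finite B → Finite A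
Finite-⊆ A⊆B (n , B<n) = n , λ y ay → B<n y (A⊆B ay)

Finite-∪ : ∀ {A B : ℕ → Set} → Finite A → Finite B → Finite (λ y → A y ⊎ B y)
Finite-∪ (m , A<m) (n , B<n) = m ⊔ n , λ y →
  [ (λ ay → <-≤-trans (A<m y ay) (m≤m⊔n m n)) , (λ by → <-≤-trans (B<n y by) (m≤n⊔m m n)) ]

Finite-≡ : ∀ a → Finite (_≡ a)
Finite-≡ a = suc a , λ { _ refl → ≤-refl }

Finite-∈ : (S : List ℕ) → Finite (_∈ S)
Finite-∈ [] = 0 , λ _ ()
Finite-∈ (a ∷ S) = Finite-⊆ (λ { (here refl) → inj₁ refl ; (there y∈S) → inj₂ y∈S })
  (Finite-∪ (Finite-≡ a) (Finite-∈ S))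

Finite-< : ∀ n → Finite (_< n)
Finite-< n = n , λ _ y<n → y<n

Finite-image : ∀ {B : ℕ → Set} → ExcludedMiddle 0ℓ → (R : ℕ → ℕ → Set) →
               (∀ {s k k′} → R s k → R s k′ → k ≡ k′) → Finite B → Finite (λ k → ∃ λ s → B s × R s k)
Finite-image {B} em R functional (n , B<n) = Finite-⊆ (λ { (s , bs , r) → s , B<n s bs , r }) (below n)
  where
  below : ∀ n → Finite (λ k → ∃ λ s → s < n × R s k)
  below zero = 0 , λ { _ (_ , () , _) }
  below (suc n) with below n | em {∃ (R n)}
  ... | fin | yes (k₀ , r₀) = Finite-⊆ shrink (Finite-∪ fin (Finite-≡ k₀))
    where
    shrink : ∀ {k} → (∃ λ s → s < suc n × R s k) → (∃ λ s → s < n × R s k) ⊎ k ≡ k₀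
    shrink (s , s<1+n , r) with m<1+n⇒m<n∨m≡n s<1+n
    ... | inj₁ s<n = inj₁ (s , s<n , r)
    ... | inj₂ refl = inj₂ (functional r r₀)
  ... | fin | no ∄ = Finite-⊆ shrink fin
    where
    shrink : ∀ {k} → (∃ λ s → s < suc n × R s k) → (∃ λ s → s < n × R s k)
    shrink (s , s<1+n , r) with m<1+n⇒m<n∨m≡n s<1+n
    ... | inj₁ s<n = s , s<n , r
    ... | inj₂ refl = ⊥-elim (∄ (_ , r))

injective⇒unbounded : (t : ℕ → ℕ) → Injective _≡_ _≡_ t → ∀ n → ¬ (∀ k → t k < n)
injective⇒unbounded t t-inj n t<n with Finₚ.pigeonhole (n<1+n n) (λ i → fromℕ< (t<n (toℕ i)))
... | i , j , i<j , eq = <⇒≢ i<j (t-inj (begin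
  t (toℕ i)                        ≡⟨ Finₚ.toℕ-fromℕ< (t<n (toℕ i)) ⟨
  toℕ (fromℕ< (t<n (toℕ i)))       ≡⟨ cong toℕ eq ⟩
  toℕ (fromℕ< (t<n (toℕ j)))       ≡⟨ Finₚ.toℕ-fromℕ< (t<n (toℕ j)) ⟩
  t (toℕ j)                        ∎))
  where open ≡-Reasoning

minimal : ExcludedMiddle 0ℓ → (P : ℕ → Set) → ∀ {k} → P k → ∃ λ m → P m × (∀ {j} → j < m → ¬ P j)
minimal em P {k} = <-rec (λ k → P k → ∃ λ m → P m × (∀ {j} → j < m → ¬ P j)) least k
  where
  least : ∀ k → (∀ {j} → j < k → P j → ∃ λ m → P m × (∀ {i} → i < m → ¬ P i)) →
          P k → ∃ λ m → P m × (∀ {j} → j < m → ¬ P j)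
  least k below pk with em {∃ λ j → j < k × P j}
  ... | yes (j , j<k , pj) = below j<k pj
  ... | no  ∄             = k , pk , λ j<k pj → ∄ (_ , j<k , pj)

-- Outside H, a vertex of H has neighbours only in the finite set F, so G and H agree on V∞ and
-- V* at the vertices of H.
module InducedDegrees (G : Graph) (P F : ℕ → Set) (F-finite : Finite F)
                      (closed : ∀ {x y} → P x → E G x y → F y ⊎ P y) where

  private
    H : Graph
    H = induce G P

  Infinite↑ : ∀ {x} → Infinite (E H x) → Infinite (E G x)
  Infinite↑ inf fin = inf (Finite-⊆ proj₁ fin)

  neighbour : ∀ {x y} → P x → E G x y → F y ⊎ E H x y
  neighbour px e = Sum.map₂ (λ py → e , px , py) (closed px e)

  Infinite↓ : ∀ {x} → P x → Infinite (E G x) → Infinite (E H x)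
  Infinite↓ px inf fin = inf (Finite-⊆ (neighbour px) (Finite-∪ F-finite fin))

  V∞↑ : ∀ {x} → V∞ H x → V∞ G x
  V∞↑ ((vx , _) , inf) = vx , Infinite↑ inf

  V∞↓ : ∀ {x} → P x → V∞ G x → V∞ H x
  V∞↓ px (vx , inf) = (vx , px) , Infinite↓ px inf

  V*↑ : ∀ {x} → V* H x → V* G x
  V*↑ {x} (v∞ , fin) = V∞↑ v∞ , Finite-⊆ split (Finite-∪ F-finite fin)
    where
    split : ∀ {y} → E G x y × V∞ G y → F y ⊎ (E H x y × V∞ H y)
    split (e , v∞y) = Sum.map₂ (λ e′ → e′ , V∞↓ (proj₂ (proj₂ e′)) v∞y) (neighbour (proj₂ (proj₁ v∞)) e)

  V*↓ : ∀ {x} → P x → V* G x → V* H x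
  V*↓ px (v∞ , fin) = V∞↓ px v∞ , Finite-⊆ (λ { (e , v∞y) → proj₁ e , V∞↑ v∞y }) fin

module Deleted (G : Graph) (S : List ℕ) =
  InducedDegrees G (_∉ S) (_∈ S) (Finite-∈ S) (λ {_} {y} _ _ → toSum (y ∈? S))

module Component (H : Graph) (r : ℕ) =
  InducedDegrees H (Reach H r) (λ _ → ⊥) (0 , λ _ ()) (λ reach e → inj₂ (step reach e))

Reach-path : ∀ {H r L} (P : Fin (suc L) → ℕ) → (∀ (i : Fin L) → E H (P (inject₁ i)) (P (fsuc i))) →
             Reach H r (P fzero) → ∀ i → Reach H r (P i)
Reach-path {L = zero}  P edges reach₀ fzero    = reach₀
Reach-path {L = suc L} P edges reach₀ fzero    = reach₀
Reach-path {L = suc L} P edges reach₀ (fsuc i) =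
  Reach-path (P ∘ fsuc) (edges ∘ fsuc) (step reach₀ (edges fzero)) i

module Comb {G : Graph} (c : CombTeethInV* G) where
  open CombTeethInV* c

  tooth : ℕ → ℕ
  tooth k = path k (fromℕ (len k))

  attachment : ℕ → ℕ
  attachment k = proj₁ (path-start k)

  path-unique : ∀ {s k l} → (∃ λ i → path k i ≡ s) → (∃ λ j → path l j ≡ s) → k ≡ l
  path-unique {k = k} {l} (i , eq) (j , eq′) with k ℕ.≟ l
  ... | yes k≡l = k≡l
  ... | no  k≢l = ⊥-elim (path-disj k l i j k≢l (trans eq (sym eq′)))

  tooth-injective : Injective _≡_ _≡_ tooth
  tooth-injective eq = path-unique (_ , eq) (_ , refl)

  restrict : {P : ℕ → Set} → (∀ n → P (ray n)) → (∀ k i → P (path k i)) →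
             (∀ {x} → P x → V* G x → V* (induce G P) x) → CombTeethInV* (induce G P)
  restrict ray-P path-P V*↓ = record
    { ray        = ray
    ; ray-V      = λ n → ray-V n , ray-P n
    ; ray-inj    = ray-inj
    ; ray-E      = λ n → ray-E n , ray-P n , ray-P (suc n)
    ; len        = len
    ; path       = path
    ; path-V     = λ k i → path-V k i , path-P k i
    ; path-inj   = path-inj
    ; path-E     = λ k i → path-E k i , path-P k _ , path-P k _
    ; path-start = path-start
    ; path-off   = path-off
    ; path-disj  = path-disj
    ; teeth      = λ k → V*↓ (path-P k _) (teeth k)
    }

  shift : (N B : ℕ) → (∀ k → N ≤ attachment (k + B)) → CombTeethInV* G
  shift N B late = record
    { ray        = λ n → ray (n + N)
    ; ray-V      = λ n → ray-V (n + N)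
    ; ray-inj    = λ m n eq → +-cancelʳ-≡ N m n (ray-inj _ _ eq)
    ; ray-E      = λ n → ray-E (n + N)
    ; len        = λ k → len (k + B)
    ; path       = λ k → path (k + B)
    ; path-V     = λ k → path-V (k + B)
    ; path-inj   = λ k → path-inj (k + B)
    ; path-E     = λ k → path-E (k + B)
    ; path-start = λ k → attachment (k + B) ∸ N ,
                         trans (proj₂ (path-start (k + B))) (cong ray (sym (m∸n+n≡m (late k))))
    ; path-off   = λ k i n → path-off (k + B) i (n + N)
    ; path-disj  = λ k l i j k≢l → path-disj (k + B) (l + B) i j (k≢l ∘ +-cancelʳ-≡ B k l)
    ; teeth      = λ k → teeth (k + B)
    }

  ray-reach : ∀ n → Reach G (ray 0) (ray n)
  ray-reach zero    = here (ray-V 0)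
  ray-reach (suc n) = step (ray-reach n) (ray-E n)

  path-reach : ∀ k i → Reach G (ray 0) (path k i)
  path-reach k = Reach-path (path k) (path-E k)
    (subst (Reach G (ray 0)) (sym (proj₂ (path-start k))) (ray-reach (attachment k)))

  inComponent : CombTeethInV* (component G (ray 0))
  inComponent = restrict ray-reach path-reach (Component.V*↓ G (ray 0))

  delete : (S : List ℕ) → (∀ n → ray n ∉ S) → (∀ k i → path k i ∉ S) → CombTeethInV* (G ─ S)
  delete S ray∉S path∉S = restrict ray∉S path∉S (Deleted.V*↓ G S)

-- Only finitely many ray vertices lie in S, say all before ray N, and only finitely many paths
-- meet S or attach to the ray before ray N: dropping those leaves a comb in G − S.
deleteTail : ExcludedMiddle 0ℓ → ∀ {G} → CombTeethInV* G → (S : List ℕ) → CombTeethInV* (G ─ S)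
deleteTail em c S = Comb.delete (shift N B (λ k → late (k + B) (m≤n+m B k))) S
  (λ n → ray∉S (n + N) (m≤n+m N n)) (λ k → path∉S (k + B) (m≤n+m B k))
  where
  open CombTeethInV* c
  open Comb c

  ray-hits : Finite (λ n → ∃ λ s → s ∈ S × ray n ≡ s)
  ray-hits = Finite-image em (λ s n → ray n ≡ s)
               (λ eq eq′ → ray-inj _ _ (trans eq (sym eq′))) (Finite-∈ S)

  N : ℕ
  N = proj₁ ray-hits

  ray∉S : ∀ n → N ≤ n → ray n ∉ S
  ray∉S n N≤n ray∈S = <⇒≱ (proj₂ ray-hits n (_ , ray∈S , refl)) N≤n

  early : Finite (λ y → ∃ λ n → n < N × ray n ≡ y)
  early = Finite-image em (λ n y → ray n ≡ y) (λ eq eq′ → trans (sym eq) eq′) (Finite-< N)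

  path-hits : Finite (λ k → ∃ λ s → (s ∈ S ⊎ ∃ λ n → n < N × ray n ≡ s) × ∃ λ i → path k i ≡ s)
  path-hits = Finite-image em (λ s k → ∃ λ i → path k i ≡ s) path-unique
                (Finite-∪ (Finite-∈ S) early)

  B : ℕ
  B = proj₁ path-hits

  path∉S : ∀ k → B ≤ k → ∀ i → path k i ∉ S
  path∉S k B≤k i path∈S = <⇒≱ (proj₂ path-hits k (_ , inj₁ path∈S , i , refl)) B≤k

  late : ∀ k → B ≤ k → N ≤ attachment k
  late k B≤k = ≮⇒≥ λ a<N →
    <⇒≱ (proj₂ path-hits k (_ , inj₂ (_ , a<N , sym (proj₂ (path-start k))) , fzero , refl)) B≤k

comb-in-component : ExcludedMiddle 0ℓ → ∀ {G} → CombTeethInV* G → (S : List ℕ) →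
                    ∃ λ r → V (G ─ S) r × CombTeethInV* (component (G ─ S) r)
comb-in-component em c S = _ , CombTeethInV*.ray-V c′ 0 , Comb.inComponent c′
  where c′ = deleteTail em c S

InWbar⇒¬comb : ExcludedMiddle 0ℓ → ∀ {G} → InWbar G → ¬ CombTeethInV* G
InWbar⇒¬comb em (base (n , V*<n)) c =
  injective⇒unbounded tooth tooth-injective n (λ k → V*<n _ (CombTeethInV*.teeth c k))
  where open Comb c
InWbar⇒¬comb em (sep S W) c with comb-in-component em c S
... | r , vr , c′ = InWbar⇒¬comb em (W r vr) c′

-- Codes name iterated components: (S , r) ∷ c stands for the component of r in sub G c − S.
Code : Set
Code = List (List ℕ × ℕ)

sub : Graph → Code → Graph
sub G []            = G
sub G ((S , r) ∷ c) = component (sub G c ─ S) r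

-- InWbar lives in Set₁, out of reach of ExcludedMiddle 0ℓ; InWbarAt is the same inductive
-- definition restricted to iterated components of a fixed graph, and is small.
data InWbarAt (G : Graph) : Code → Set where
  base : ∀ {c} → InW (sub G c) → InWbarAt G c
  sep  : ∀ {c} (S : List ℕ) → (∀ r → V (sub G c ─ S) r → InWbarAt G ((S , r) ∷ c)) → InWbarAt G c

InWbarAt⇒InWbar : ∀ {G c} → InWbarAt G c → InWbar (sub G c)
InWbarAt⇒InWbar (base w)  = base w
InWbarAt⇒InWbar (sep S W) = sep S (λ r vr → InWbarAt⇒InWbar (W r vr))

sub-V : ∀ {G} c {x} → V (sub G c) x → V G x
sub-V []      vx = vx
sub-V (_ ∷ c) vx = sub-V c (proj₁ (proj₁ vx))

sub-E : ∀ {G} c {x y} → E (sub G c) x y → E G x y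
sub-E []      e = e
sub-E (_ ∷ c) e = sub-E c (proj₁ (proj₁ e))

sub-V* : ∀ {G} c {x} → V* (sub G c) x → V* G x
sub-V* []            = id
sub-V* {G} ((S , r) ∷ c) = sub-V* c ∘ Deleted.V*↑ (sub G c) S ∘ Component.V*↑ (sub G c ─ S) r

data Walk (H : Graph) : ℕ → ℕ → ℕ → Set where
  stop : ∀ {a} → V H a → Walk H a a 0
  _▸_  : ∀ {a b c k} → E H a b → Walk H b c k → Walk H a c (suc k)

Connected : Graph → ℕ → ℕ → Set
Connected H a b = ∃ (Walk H a b)

module _ {H : Graph} where

  Connected-trans : ∀ {a b c} → Connected H a b → Connected H b c → Connected H a c
  Connected-trans (_ , stop _)  w = w
  Connected-trans (_ , e ▸ w)   w′ with Connected-trans (_ , w) w′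
  ... | k , w″ = suc k , e ▸ w″

  Connected-sym : ∀ {a b} → Connected H a b → Connected H b a
  Connected-sym (_ , stop va) = _ , stop va
  Connected-sym (_ , e ▸ w)   =
    Connected-trans (Connected-sym (_ , w)) (1 , E-sym H e ▸ stop (proj₁ (E-V H e)))

Reach⇒Connected : ∀ {H r y} → Reach H r y → Connected (component H r) y r
Reach⇒Connected (here vr) = 0 , stop (vr , here vr)
Reach⇒Connected {H} (step rx e) with Reach⇒Connected rx
... | k , w = suc k , (E-sym H e , step rx e , rx) ▸ w

component-connected : ∀ {H r a b} → V (component H r) a → V (component H r) b →
                      Connected (component H r) a b
component-connected (_ , ra) (_ , rb) =
  Connected-trans (Reach⇒Connected ra) (Connected-sym (Reach⇒Connected rb))

module EntryInto (C : Graph) (S : List ℕ) (r : ℕ) where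

  C′ : Graph
  C′ = component (C ─ S) r

  record Entry : Set where
    field
      from   : ℕ
      to     : ℕ
      from∈S : from ∈ S
      to-V   : V C′ to
      edge   : E C from to

  walk-enters : ∀ {a z k} → Walk C a z k → V C′ z → V C′ a ⊎ Entry
  walk-enters (stop _) vz = inj₁ vz
  walk-enters {a} (_▸_ {b = b} e w) vz with walk-enters w vz
  ... | inj₂ entry = inj₂ entry
  ... | inj₁ vb with a ∈? S
  ...   | yes a∈S = inj₂ (record { from∈S = a∈S ; to-V = vb ; edge = e })
  ...   | no  a∉S = inj₁ ((proj₁ (E-V C e) , a∉S) , step (proj₂ vb) (E-sym C e , proj₂ (proj₁ vb) , a∉S))

  walk-from-S-enters : ∀ {a z k} → a ∈ S → Walk C a z k → V C′ z → Entry
  walk-from-S-enters a∈S w vz with walk-enters w vz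
  ... | inj₁ va    = ⊥-elim (proj₂ (proj₁ va) a∈S)
  ... | inj₂ entry = entry

record Path (H : Graph) (a b : ℕ) : Set where
  field
    length       : ℕ
    vertex       : Fin (suc length) → ℕ
    vertex-first : vertex fzero ≡ a
    vertex-last  : vertex (fromℕ length) ≡ b
    vertex-V     : ∀ i → V H (vertex i)
    vertex-E     : ∀ (i : Fin length) → E H (vertex (inject₁ i)) (vertex (fsuc i))
    vertex-inj   : ∀ i j → vertex i ≡ vertex j → i ≡ j

-- A shortest walk visits no vertex twice, since every later vertex is closer to b than a is.
shortest⇒Path : ∀ {H b} k {a} → Walk H a b k → (∀ {j} → j < k → ¬ Walk H a b j) →
                Σ (Path H a b) λ p → ∀ i → ∃ λ m → m ≤ k × Walk H (Path.vertex p i) b m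
shortest⇒Path zero {a} (stop va) _ = p , λ _ → 0 , z≤n , stop va
  where
  p : Path _ a a
  p = record { length = 0 ; vertex = λ _ → a ; vertex-first = refl ; vertex-last = refl
             ; vertex-V = λ _ → va ; vertex-E = λ () ; vertex-inj = λ { fzero fzero _ → refl } }
shortest⇒Path {H} {b} (suc k) {a} (e ▸ w) shortest = p , closer
  where
  rest : Σ (Path H _ b) λ p → ∀ i → ∃ λ m → m ≤ k × Walk H (Path.vertex p i) b m
  rest = shortest⇒Path k w (λ j<k w′ → shortest (s≤s j<k) (e ▸ w′))
  open Path (proj₁ rest)

  vertex′ : Fin (suc (suc length)) → ℕ
  vertex′ fzero    = a
  vertex′ (fsuc i) = vertex i

  closer : ∀ i → ∃ λ m → m ≤ suc k × Walk H (vertex′ i) b m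
  closer fzero    = suc k , ≤-refl , e ▸ w
  closer (fsuc i) with proj₂ rest i
  ... | m , m≤k , w′ = m , m≤n⇒m≤1+n m≤k , w′

  a∉rest : ∀ i → a ≢ vertex i
  a∉rest i a≡ with proj₂ rest i
  ... | m , m≤k , w′ = shortest (s≤s m≤k) (subst (λ x → Walk H x b m) (sym a≡) w′)

  p : Path H a b
  p = record
    { length       = suc length
    ; vertex       = vertex′
    ; vertex-first = refl
    ; vertex-last  = vertex-last
    ; vertex-V     = λ { fzero → proj₁ (E-V H e) ; (fsuc i) → vertex-V i }
    ; vertex-E     = λ { fzero → subst (E H a) (sym vertex-first) e ; (fsuc i) → vertex-E i }
    ; vertex-inj   = λ { fzero fzero _ → refl
                       ; fzero (fsuc j) eq → ⊥-elim (a∉rest j eq)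
                       ; (fsuc i) fzero eq → ⊥-elim (a∉rest i (sym eq))
                       ; (fsuc i) (fsuc j) eq → cong fsuc (vertex-inj i j eq) }
    }

Connected⇒Path : ExcludedMiddle 0ℓ → ∀ {H a b} → Connected H a b → Path H a b
Connected⇒Path em {H} {a} {b} (_ , w) with minimal em (Walk H a b) w
... | k , shortest , none-shorter = proj₁ (shortest⇒Path k shortest none-shorter)

module _ {H a b} (p : Path H a b) where
  open Path p

  vertexAt : (j : ℕ) → j ≤ length → ℕ
  vertexAt j j≤ = vertex (fromℕ< (s≤s j≤))

  at-cong : ∀ {j j′} (j≤ : j ≤ length) (j′≤ : j′ ≤ length) → j ≡ j′ → vertexAt j j≤ ≡ vertexAt j′ j′≤
  at-cong j≤ j′≤ refl = cong vertex (Finₚ.toℕ-injective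
    (trans (Finₚ.toℕ-fromℕ< (s≤s j≤)) (sym (Finₚ.toℕ-fromℕ< (s≤s j′≤)))))

  at-inj : ∀ {j j′} (j≤ : j ≤ length) (j′≤ : j′ ≤ length) → vertexAt j j≤ ≡ vertexAt j′ j′≤ → j ≡ j′
  at-inj {j} {j′} j≤ j′≤ eq = begin
    j                         ≡⟨ Finₚ.toℕ-fromℕ< (s≤s j≤) ⟨
    toℕ (fromℕ< (s≤s j≤))     ≡⟨ cong toℕ (vertex-inj _ _ eq) ⟩
    toℕ (fromℕ< (s≤s j′≤))    ≡⟨ Finₚ.toℕ-fromℕ< (s≤s j′≤) ⟩
    j′                        ∎
    where open ≡-Reasoning

  at-toℕ : ∀ i → vertex i ≡ vertexAt (toℕ i) (Finₚ.toℕ≤pred[n] i)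
  at-toℕ i = cong vertex (sym (Finₚ.fromℕ<-toℕ i _))

  at-E : ∀ {j} (j< : j < length) → E H (vertexAt j (<⇒≤ j<)) (vertexAt (suc j) j<)
  at-E {j} j< = subst₂ (E H)
    (trans (at-toℕ (inject₁ i)) (at-cong (Finₚ.toℕ≤pred[n] _) (<⇒≤ j<)
      (trans (Finₚ.toℕ-inject₁ i) (Finₚ.toℕ-fromℕ< j<))))
    (trans (at-toℕ (fsuc i)) (at-cong (Finₚ.toℕ≤pred[n] _) j< (cong suc (Finₚ.toℕ-fromℕ< j<))))
    (vertex-E i)
    where i = fromℕ< j<

  at-last : vertexAt length ≤-refl ≡ b
  at-last = trans (sym last≡) vertex-last
    where
    last≡ : vertex (fromℕ length) ≡ vertexAt length ≤-refl
    last≡ = trans (at-toℕ (fromℕ length)) (at-cong (Finₚ.toℕ≤pred[n] _) ≤-refl (Finₚ.toℕ-fromℕ length))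

record Stage (G : Graph) : Set where
  field
    code       : Code
    not-InWbar : ¬ InWbarAt G code
    root       : ℕ
    connected  : ∀ {y} → V (sub G code) y → Connected (sub G code) root y

  graph : Graph
  graph = sub G code

record Extension {G : Graph} (st : Stage G) : Set where
  open Stage st
  field
    tip    : ℕ
    tip-V* : V* G tip
    path   : Path graph root tip
    exit   : Fin (suc (Path.length path))
    next   : Stage G
    exit-E : E G (Path.vertex path exit) (Stage.root next)
    nested : ∀ {z} → V (Stage.graph next) z → V graph z × (∀ j → Path.vertex path j ≢ z)

-- Kept opaque: unfolding the classical choices made here exhausts the type checker.
opaque
  extend : ExcludedMiddle 0ℓ → ∀ {G} (st : Stage G) → Extension st
  extend em {G} st = record
    { tip    = u
    ; tip-V* = sub-V* code u-V*
    ; path   = p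
    ; exit   = proj₁ from-on-p
    ; next   = next
    ; exit-E = sub-E code (subst (λ z → E graph z to) (proj₂ from-on-p) edge)
    ; nested = λ vz → proj₁ (proj₁ vz) , λ j eq →
                 proj₂ (proj₁ vz) (subst (_∈ S) eq (∈-tabulate⁺ {f = vertex} j))
    }
    where
    open Stage st
    dne : DoubleNegationElimination 0ℓ
    dne = em⇒dne em

    u-exists : ∃ (V* graph)
    u-exists = dne λ ∄ → not-InWbar (base (0 , λ y u-V* → ⊥-elim (∄ (y , u-V*))))

    u : ℕ
    u = proj₁ u-exists

    u-V* : V* graph u
    u-V* = proj₂ u-exists

    p : Path graph root u
    p = Connected⇒Path em (connected (proj₁ (proj₁ u-V*)))
    open Path p

    S : List ℕ
    S = tabulate vertex

    bad-component : ∃ λ r → V (graph ─ S) r × ¬ InWbarAt G ((S , r) ∷ code)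
    bad-component = dne λ ∄ → not-InWbar (sep S λ r vr → dne λ ¬W → ∄ (r , vr , ¬W))

    r : ℕ
    r = proj₁ bad-component

    r-V : V (graph ─ S) r
    r-V = proj₁ (proj₂ bad-component)

    open EntryInto graph S r

    entry : Entry
    entry = walk-from-S-enters (subst (_∈ S) vertex-first (∈-tabulate⁺ {f = vertex} fzero))
              (proj₂ (connected (proj₁ r-V))) (r-V , here r-V)
    open Entry entry

    from-on-p : ∃ λ i → from ≡ vertex i
    from-on-p = ∈-tabulate⁻ {f = vertex} from∈S

    next : Stage G
    next = record
      { code       = (S , r) ∷ code
      ; not-InWbar = proj₂ (proj₂ bad-component)
      ; root       = to
      ; connected  = component-connected to-V
      }

-- Enumeration of the positions (s , j), j ≤ last s, block by block.
module Blocks (last : ℕ → ℕ) where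

  Pos : Set
  Pos = Σ ℕ λ s → Σ ℕ λ j → j ≤ last s

  block place : Pos → ℕ
  block = proj₁
  place = proj₁ ∘ proj₂

  next : Pos → Pos
  next (s , j , _) with j <? last s
  ... | yes j<last = s , suc j , j<last
  ... | no  _      = suc s , 0 , z≤n

  data Next : Pos → Pos → Set where
    within : ∀ {s j} {j≤ : j ≤ last s} (j< : j < last s) → Next (s , j , j≤) (s , suc j , j<)
    across : ∀ {s} {j≤ : last s ≤ last s} → Next (s , last s , j≤) (suc s , 0 , z≤n)

  next-view : ∀ p → Next p (next p)
  next-view (s , j , j≤) with j <? last s
  ... | yes j< = within j<
  ... | no  j≮ with ≤-antisym j≤ (≮⇒≥ j≮)
  ...   | refl = across

  pos : ℕ → Pos
  pos zero    = 0 , 0 , z≤n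
  pos (suc m) = next (pos m)

  offset : ℕ → ℕ
  offset zero    = 0
  offset (suc s) = offset s + suc (last s)

  index : Pos → ℕ
  index (s , j , _) = offset s + j

  index-Next : ∀ {p q} → Next p q → index q ≡ suc (index p)
  index-Next {s , j , _} (within _) = +-suc (offset s) j
  index-Next {s , _ , _} across     = trans (+-identityʳ _) (+-suc (offset s) (last s))

  index-pos : ∀ m → index (pos m) ≡ m
  index-pos zero    = refl
  index-pos (suc m) = trans (index-Next (next-view (pos m))) (cong suc (index-pos m))

  Next-within : ∀ {p q} → Next p q → place p < last (block p) →
                block q ≡ block p × place q ≡ suc (place p)
  Next-within (within _) _   = refl , refl
  Next-within across     j<j = ⊥-elim (n≮n _ j<j)

  Next-across : ∀ {p q} → Next p q → place p ≡ last (block p) →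
                block q ≡ suc (block p) × place q ≡ 0
  Next-across (within j<) j≡ = ⊥-elim (<⇒≢ j< j≡)
  Next-across across      _  = refl , refl

  pos-onto : ∀ s j → j ≤ last s → ∃ λ m → block (pos m) ≡ s × place (pos m) ≡ j
  pos-onto zero    zero    _  = 0 , refl , refl
  pos-onto (suc s) zero    _  with pos-onto s (last s) ≤-refl
  ... | m , refl , j≡ with Next-across (next-view (pos m)) j≡
  ...   | b≡ , j≡0 = suc m , b≡ , j≡0
  pos-onto s       (suc j) j< with pos-onto s j (<⇒≤ j<)
  ... | m , refl , refl with Next-within (next-view (pos m)) j<
  ...   | b≡ , j≡ = suc m , b≡ , j≡

module Construction (em : ExcludedMiddle 0ℓ) (G : Graph) (not-W : ¬ InWbarAt G []) where

  start : Stage G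
  start = record
    { code       = ([] , r) ∷ []
    ; not-InWbar = proj₂ (proj₂ bad)
    ; root       = r
    ; connected  = component-connected r-V
    }
    where
    bad : ∃ λ r → V (G ─ []) r × ¬ InWbarAt G (([] , r) ∷ [])
    bad = em⇒dne em λ ∄ → not-W (sep [] λ r vr → em⇒dne em λ ¬W → ∄ (r , vr , ¬W))

    r : ℕ
    r = proj₁ bad

    r-V : V (component (G ─ []) r) r
    r-V = proj₁ (proj₂ bad) , here (proj₁ (proj₂ bad))

  stage : ℕ → Stage G
  stage zero    = start
  stage (suc s) = Extension.next (extend em (stage s))

  module _ (s : ℕ) where
    open Extension (extend em (stage s)) public
    open Stage (stage s) public using (code)

  ℓ : ℕ → ℕ
  ℓ s = Path.length (path s)

  exitAt : ℕ → ℕ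
  exitAt s = toℕ (exit s)

  exit≤ℓ : ∀ s → exitAt s ≤ ℓ s
  exit≤ℓ s = Finₚ.toℕ≤pred[n] (exit s)

  vtx : ∀ s j → j ≤ ℓ s → ℕ
  vtx s = vertexAt (path s)

  vtx-cong : ∀ s {j j′} (j≤ : j ≤ ℓ s) (j′≤ : j′ ≤ ℓ s) → j ≡ j′ → vtx s j j≤ ≡ vtx s j′ j′≤
  vtx-cong s = at-cong (path s)

  vtx-inj : ∀ s {j j′} (j≤ : j ≤ ℓ s) (j′≤ : j′ ≤ ℓ s) → vtx s j j≤ ≡ vtx s j′ j′≤ → j ≡ j′
  vtx-inj s = at-inj (path s)

  vtx-V : ∀ s {j} (j≤ : j ≤ ℓ s) → V G (vtx s j j≤)
  vtx-V s _ = sub-V (code s) (Path.vertex-V (path s) _)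

  vtx-E : ∀ s {j} (j< : j < ℓ s) → E G (vtx s j (<⇒≤ j<)) (vtx s (suc j) j<)
  vtx-E s j< = sub-E (code s) (at-E (path s) j<)

  vtx-exit : ∀ s → E G (vtx s (exitAt s) (exit≤ℓ s)) (vtx (suc s) 0 z≤n)
  vtx-exit s =
    subst₂ (E G) (at-toℕ (path s) (exit s)) (sym (Path.vertex-first (path (suc s)))) (exit-E s)

  vtx-tip : ∀ s → V* G (vtx s (ℓ s) ≤-refl)
  vtx-tip s = subst (V* G) (sym (at-last (path s))) (tip-V* s)

  graph : ℕ → Graph
  graph s = Stage.graph (stage s)

  graph-⊆ : ∀ {s t z} → s ≤′ t → V (graph t) z → V (graph s) z
  graph-⊆         ≤′-refl        vz = vz
  graph-⊆ {t = t} (≤′-step s≤t) vz = graph-⊆ s≤t (proj₁ (nested (ℕ.pred t) vz))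

  vtx-disjoint< : ∀ {s s′ j j′} (j≤ : j ≤ ℓ s) (j′≤ : j′ ≤ ℓ s′) → s < s′ → vtx s j j≤ ≢ vtx s′ j′ j′≤
  vtx-disjoint< {s} {s′} j≤ j′≤ s<s′ =
    proj₂ (nested s (graph-⊆ (≤⇒≤′ s<s′) (Path.vertex-V (path s′) (fromℕ< (s≤s j′≤))))) (fromℕ< (s≤s j≤))

  vtx-disjoint : ∀ {s s′ j j′} (j≤ : j ≤ ℓ s) (j′≤ : j′ ≤ ℓ s′) → s ≢ s′ → vtx s j j≤ ≢ vtx s′ j′ j′≤
  vtx-disjoint {s} {s′} j≤ j′≤ s≢s′ with <-cmp s s′
  ... | tri< s<s′ _ _ = vtx-disjoint< j≤ j′≤ s<s′
  ... | tri≈ _ s≡s′ _ = ⊥-elim (s≢s′ s≡s′)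
  ... | tri> _ _ s′<s = vtx-disjoint< j′≤ j≤ s′<s ∘ sym

  -- Stage s contributes vertices 0, …, exitAt s of its path to the ray and the rest to tooth s.
  open Blocks exitAt

  ray-bound : ∀ p → place p ≤ ℓ (block p)
  ray-bound (s , _ , j≤) = ≤-trans j≤ (exit≤ℓ s)

  ray : Pos → ℕ
  ray p = vtx (block p) (place p) (ray-bound p)

  ray-at : ∀ p {s j} (j≤ : j ≤ ℓ s) → block p ≡ s → place p ≡ j → ray p ≡ vtx s j j≤
  ray-at p@(s , j , _) j≤ refl refl = vtx-cong s (ray-bound p) j≤ refl

  ray-inj : ∀ p p′ → ray p ≡ ray p′ → index p ≡ index p′
  ray-inj p@(s , _ , _) p′@(s′ , _ , _) eq with s ℕ.≟ s′
  ... | yes refl = cong (offset s +_) (vtx-inj s (ray-bound p) (ray-bound p′) eq)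
  ... | no  s≢s′ = ⊥-elim (vtx-disjoint (ray-bound p) (ray-bound p′) s≢s′ eq)

  ray-Next : ∀ {p q} → Next p q → E G (ray p) (ray q)
  ray-Next {p@(s , _ , _)} {q} (within _) =
    subst₂ (E G) (vtx-cong s (<⇒≤ (ray-bound q)) (ray-bound p) refl) refl (vtx-E s (ray-bound q))
  ray-Next {p@(s , _ , _)} across =
    subst₂ (E G) (vtx-cong s (exit≤ℓ s) (ray-bound p) refl) refl (vtx-exit s)

  tooth-len : ℕ → ℕ
  tooth-len k = ℓ k ∸ exitAt k

  tooth-bound : ∀ k (t : Fin (suc (tooth-len k))) → exitAt k + toℕ t ≤ ℓ k
  tooth-bound k t = subst (exitAt k + toℕ t ≤_) (m+[n∸m]≡n (exit≤ℓ k))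
                      (+-monoʳ-≤ (exitAt k) (Finₚ.toℕ≤pred[n] t))

  tooth-path : (k : ℕ) → Fin (suc (tooth-len k)) → ℕ
  tooth-path k t = vtx k (exitAt k + toℕ t) (tooth-bound k t)

  tooth-path-E : ∀ k (t : Fin (tooth-len k)) → E G (tooth-path k (inject₁ t)) (tooth-path k (fsuc t))
  tooth-path-E k t = subst₂ (E G)
    (vtx-cong k (<⇒≤ t<) (tooth-bound k (inject₁ t)) (cong (exitAt k +_) (sym (Finₚ.toℕ-inject₁ t))))
    (vtx-cong k t< (tooth-bound k (fsuc t)) (sym (+-suc (exitAt k) (toℕ t))))
    (vtx-E k t<)
    where
    t< : exitAt k + toℕ t < ℓ k
    t< = subst (_≤ ℓ k) (+-suc (exitAt k) (toℕ t)) (tooth-bound k (fsuc t))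

  tooth-path-start : ∀ k → ∃ λ m → tooth-path k fzero ≡ ray (pos m)
  tooth-path-start k with pos-onto k (exitAt k) ≤-refl
  ... | m , in-k , at-exit =
    m , trans (vtx-cong k (tooth-bound k fzero) (exit≤ℓ k) (+-identityʳ (exitAt k)))
              (sym (ray-at (pos m) (exit≤ℓ k) in-k at-exit))

  tooth-path-off : ∀ k (t : Fin (tooth-len k)) p → tooth-path k (fsuc t) ≢ ray p
  tooth-path-off k t p@(s , j , j≤) eq with k ℕ.≟ s
  ... | no  k≢s  = vtx-disjoint (tooth-bound k (fsuc t)) (ray-bound p) k≢s eq
  ... | yes refl = <⇒≱ (m<m+n (exitAt k) z<s)
                       (subst (_≤ exitAt k) (sym (vtx-inj k (tooth-bound k (fsuc t)) (ray-bound p) eq)) j≤)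

  tooth-V* : ∀ k → V* G (tooth-path k (fromℕ (tooth-len k)))
  tooth-V* k = subst (V* G) (vtx-cong k ≤-refl (tooth-bound k _) ℓ≡) (vtx-tip k)
    where
    ℓ≡ : ℓ k ≡ exitAt k + toℕ (fromℕ (tooth-len k))
    ℓ≡ = trans (sym (m+[n∸m]≡n (exit≤ℓ k))) (cong (exitAt k +_) (sym (Finₚ.toℕ-fromℕ (tooth-len k))))

  comb : CombTeethInV* G
  comb = record
    { ray        = ray ∘ pos
    ; ray-V      = λ m → vtx-V (block (pos m)) (ray-bound (pos m))
    ; ray-inj    = λ m n eq →
                     trans (sym (index-pos m)) (trans (ray-inj (pos m) (pos n) eq) (index-pos n))
    ; ray-E      = λ m → ray-Next (next-view (pos m))
    ; len        = tooth-len
    ; path       = tooth-path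
    ; path-V     = λ k t → vtx-V k (tooth-bound k t)
    ; path-inj   = λ k t t′ eq → Finₚ.toℕ-injective
                     (+-cancelˡ-≡ (exitAt k) _ _ (vtx-inj k (tooth-bound k t) (tooth-bound k t′) eq))
    ; path-E     = tooth-path-E
    ; path-start = tooth-path-start
    ; path-off   = λ k t n → tooth-path-off k t (pos n)
    ; path-disj  = λ k l t t′ k≢l → vtx-disjoint (tooth-bound k t) (tooth-bound l t′) k≢l
    ; teeth      = tooth-V*
    }

¬comb⇒InWbar : ExcludedMiddle 0ℓ → ∀ G → ¬ CombTeethInV* G → InWbar G
¬comb⇒InWbar em G ¬comb = InWbarAt⇒InWbar (em⇒dne em λ ¬W → ¬comb (Construction.comb em G ¬W))

proposition8 : ExcludedMiddle 0ℓ → (G : Graph) →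
    (InWbar G → ¬ CombTeethInV* G) × (¬ CombTeethInV* G → InWbar G)
proposition8 em G = InWbar⇒¬comb em , ¬comb⇒InWbar em G
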